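{- Let $U=(V,E)$ be an undirected graph with $V=\{x_1,\ldots,x_n\}$ and let $b=\lceil \log n\rceil$. Construct a push-down system $\mathcal{P}=(Q,\Gamma,\delta)$ with stack alphabet $\Gamma=\{0,1\}$ as follows. The ordinary states are $q_s$, $q_t$ and $a_i,b_i,c_i,d_i$ for $i\in\{1,\ldots,n\}$. The following macro-transitions are added: (1) for each $i\in\{1,\ldots,n\}$: from $q_s$, push the word $[i]_2$ onto the stack and go to $a_i$; (2) for each ordered pair $(i,j)$ with $\{x_i,x_j\}\in E$: from $a_i$ go to $b_j$, from $b_i$ go to $c_j$, and from $c_i$ go to $d_j$, each without reading or writing the stack; (3) for each $i\in\{1,\ldots,n\}$: from $d_i$, pop the word $[i]_2$ (that is, pop $b$ symbols, which is possible exactly when the top $b$ stack symbols are the ones pushed by a push of $[i]_2$, read in reverse order) and go to $q_t$. Each macro-transition that pushes or pops several symbols is realized by a chain of transitions each of which either pushes exactly one symbol without popping or pops exactly one symbol without pushing, passing through fresh auxiliary states; each macro-transition of type (2) is realized by two stack-neutral transitions through one fresh auxiliary state. Then $q_t$ is reachable from $q_s$ in $\mathcal{P}$ (i.e., there is a path from $(q_s,\epsilon)$ to $(q_t,\epsilon)$ in the configuration graph of $\mathcal{P}$) if and only if $U$ contains a triangle (three vertices pairwise joined by edges).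
   Context: For an integer $i$, $[i]_2$ denotes the binary representation of $i$, padded with leading zeros to length $\lceil \log n\rceil$ (logarithms are base 2). A push-down system (PDS) is a triple $\mathcal{P}=(Q,\Gamma,\delta)$ with a finite set $Q$ of control states, a finite stack alphabet $\Gamma$, and a transition relation $\delta\subseteq Q\times(\Gamma\cup\{\epsilon\})\times Q\times\Gamma^*$. A configuration is a pair $(q,w)\in Q\times\Gamma^*$ ($w$ is the stack content, leftmost symbol on top). The configuration graph has an edge $(q_1,w_1)\to(q_2,w_2)$ when $(q_1,\gamma,q_2,w)\in\delta$ and either $\gamma=\epsilon$, $w_1=\epsilon$... more precisely: either ($w_1=\gamma=\epsilon$ and $w_2=w$) or ($\gamma\neq\epsilon$ and $w_1=\gamma w'$, $w_2=ww'$ for some $w'\in\Gamma^*$). A transition $(p,\epsilon,q,g)$ with $g\in\Gamma$ pushes $g$; a transition $(p,g,q,\epsilon)$ pops $g$. State $q_t$ is reachable from $q_s$ if there is a path from $(q_s,\epsilon)$ to $(q_t,\epsilon)$ in the configuration graph. -}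

module Defs where

open import Data.Nat using (ℕ; zero; suc; _+_; _∸_; _^_; _≡ᵇ_; NonZero)
open import Data.Nat.Properties using (m^n≢0)
open import Data.Nat.DivMod using (_/_; _%_)
open import Data.Nat.Logarithm using (⌈log₂_⌉)
open import Data.Bool using (Bool; true; false; if_then_else_)
open import Data.Fin using (Fin; toℕ; opposite)
open import Data.Vec using (Vec; []; _∷_; lookup)
open import Data.List using (List; []; _∷_; _++_)
open import Data.Maybe using (Maybe; just; nothing)
open import Data.Product using (_×_; _,_; ∃-syntax)
open import Relation.Binary.PropositionalEquality using (_≢_)
open import Relation.Binary.Construct.Closure.ReflexiveTransitive using (Star)

record PDS : Set₁ where
  field
    Q : Set
    Γ : Set
    -- δ p γ q w  means  (p, γ, q, w) ∈ δ ;  γ = nothing encodes ε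
    δ : Q → Maybe Γ → Q → List Γ → Set

module _ (P : PDS) where
  open PDS P

  Config : Set
  Config = Q × List Γ

  -- edges of the configuration graph (stack top = head of the list)
  data Step : Config → Config → Set where
    step-ε   : ∀ {q₁ q₂ w w'} → δ q₁ nothing q₂ w →
               Step (q₁ , w') (q₂ , w ++ w')
    step-pop : ∀ {q₁ q₂ g w w'} → δ q₁ (just g) q₂ w →
               Step (q₁ , g ∷ w') (q₂ , w ++ w')

  Reachable : Q → Q → Set
  Reachable qs qt = Star Step (qs , []) (qt , [])

-- Binary representation [m]_2 padded to length len, most significant bit
-- first; true = 1, false = 0.

bin : (len m : ℕ) → Vec Bool len
bin zero    m = []
bin (suc l) m = ((m / (2 ^ l)) {{m^n≢0 2 l}} % 2 ≡ᵇ 1) ∷ bin l m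

-- The construction.  Vertices x_1..x_n are represented by Fin n, i.e.
-- indices 0..n-1, whose codes fit in b = ⌈log n⌉ bits.

nbits : ℕ → ℕ
nbits n = ⌈log₂ n ⌉

code : {n : ℕ} → Fin n → Vec Bool (nbits n)
code {n} i = bin (nbits n) (toℕ i)

data Layer : Set where
  ab bc cd : Layer

data State (n : ℕ) : Set where
  q-s q-t : State n
  a b c d : Fin n → State n
  pushAux : Fin n → ℕ → State n          -- after pushing k symbols of [i]_2
  popAux  : Fin n → ℕ → State n          -- after popping k symbols of [i]_2
  edgeAux : Layer → Fin n → Fin n → State n  -- middle of a type (2) macro

src tgt : {n : ℕ} → Layer → Fin n → State n
src ab = a
src bc = b
src cd = c
tgt ab = b
tgt bc = c
tgt cd = d

pushSt : {n : ℕ} → Fin n → ℕ → State n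
pushSt {n} i k =
  if k ≡ᵇ 0 then q-s else (if k ≡ᵇ nbits n then a i else pushAux i k)

popSt : {n : ℕ} → Fin n → ℕ → State n
popSt {n} i k =
  if k ≡ᵇ 0 then d i else (if k ≡ᵇ nbits n then q-t else popAux i k)

data Trans {n : ℕ} (E : Fin n → Fin n → Set)
     : State n → Maybe Bool → State n → List Bool → Set where
  push  : (i : Fin n) (k : Fin (nbits n)) →
          Trans E (pushSt i (toℕ k)) nothing (pushSt i (suc (toℕ k)))
                  (lookup (code i) k ∷ [])
  -- (3) k-th pop of [i]_2 (bits popped in reverse order)
  pop   : (i : Fin n) (k : Fin (nbits n)) →
          Trans E (popSt i (toℕ k)) (just (lookup (code i) (opposite k)))
                  (popSt i (suc (toℕ k))) []
  edge₁ : (l : Layer) (i j : Fin n) → E i j →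
          Trans E (src l i) nothing (edgeAux l i j) []
  edge₂ : (l : Layer) (i j : Fin n) → E i j →
          Trans E (edgeAux l i j) nothing (tgt l j) []

𝒫 : (n : ℕ) → (Fin n → Fin n → Set) → PDS
𝒫 n E = record { Q = State n ; Γ = Bool ; δ = Trans E }

Triangle : {n : ℕ} → (Fin n → Fin n → Set) → Set
Triangle {n} E = ∃[ x ] ∃[ y ] ∃[ z ]
  (x ≢ y × y ≢ z × x ≢ z × E x y × E y z × E x z)

{-# OPTIONS --safe #-}
-- A run from (q_s, ε) to (q_t, ε) pushes the code of some vertex
-- i, follows three edges to a vertex j, and then pops the code of j; popping
-- succeeds only if the two codes agree bit by bit.  Since n ≤ 2 ^ ⌈log₂ n⌉,
-- codes of distinct vertices differ, so i = j and the run traces a closed walk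
-- of length 3, which in a loopless graph is a triangle.  Conversely, a triangle
-- x y z yields the run: push [x]₂, go x → y → z → x, pop [x]₂.
module Submission where

open import Defs
open import Data.Nat using (ℕ; zero; suc; _+_; _*_; _∸_; _^_; _≡ᵇ_; NonZero; _≤_; _<_; z≤n; s≤s; ⌈_/2⌉)
open import Data.Nat.Properties
open import Data.Nat.DivMod using (_/_; _%_; m≡m%n+[m/n]*n; m∣n⇒o%n%m≡o%m; m%[n*o]/o≡m/o%n; m%n<n; n%1≡0; m<n⇒m%n≡m)
open import Data.Nat.Divisibility using (divides)
open import Data.Nat.Logarithm using (⌈log₂⌉-mono-≤)
open import Data.Nat.Logarithm.Core using (⌈log2⌉)
open import Data.Nat.Induction using (<-wellFounded)
open import Induction.WellFounded using (Acc; acc)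
open import Data.Bool using (Bool; true; false; T; if_then_else_)
open import Data.Fin using (Fin; toℕ; opposite; fromℕ<) renaming (zero to fzero; suc to fsuc)
open import Data.Fin.Properties using (toℕ-injective; toℕ<n; toℕ-fromℕ<; opposite-prop)
open import Data.Vec using (Vec; []; _∷_; lookup)
import Data.Vec.Properties as Vec
open import Data.List using (List; []; _∷_)
import Data.List.Properties as List
open import Data.Product using (_×_; _,_; ∃-syntax)
open import Data.Sum using (inj₁; inj₂)
open import Data.Empty using (⊥-elim)
open import Function using (_∘_)
open import Relation.Nullary using (contradiction)
open import Relation.Binary.Definitions using (Symmetric; Irreflexive)
open import Relation.Binary.PropositionalEquality
  using (_≡_; _≢_; refl; sym; trans; cong; cong₂; subst; subst₂; module ≡-Reasoning)
open import Relation.Binary.Construct.Closure.ReflexiveTransitive using (Star; ε; _◅_; _◅◅_)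
open import Function.Bundles using (_⇔_; mk⇔)

open ≡-Reasoning

bit-injective : ∀ {u v} → u < 2 → v < 2 → (u ≡ᵇ 1) ≡ (v ≡ᵇ 1) → u ≡ v
bit-injective {0}           {0}           _              _              _  = refl
bit-injective {1}           {1}           _              _              _  = refl
bit-injective {0}           {1}           _              _              ()
bit-injective {1}           {0}           _              _              ()
bit-injective {suc (suc _)} {_}           (s≤s (s≤s ())) _              _
bit-injective {_}           {suc (suc _)} _              (s≤s (s≤s ())) _

module _ {n : ℕ} .⦃ _ : NonZero n ⦄ where
  private instance
    2*n≢0 : NonZero (2 * n)
    2*n≢0 = m*n≢0 2 n

  m%[2*n]≡m%n+[m/n%2]*n : ∀ m → m % (2 * n) ≡ m % n + m / n % 2 * n
  m%[2*n]≡m%n+[m/n%2]*n m = begin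
    m % (2 * n)
      ≡⟨ m≡m%n+[m/n]*n (m % (2 * n)) n ⟩
    m % (2 * n) % n + m % (2 * n) / n * n
      ≡⟨ cong₂ _+_ (m∣n⇒o%n%m≡o%m n (2 * n) m (divides 2 refl))
                   (cong (_* n) (m%[n*o]/o≡m/o%n m 2 n)) ⟩
    m % n + m / n % 2 * n ∎

bin≡⇒%2^≡ : ∀ l .⦃ _ : NonZero (2 ^ l) ⦄ x y → bin l x ≡ bin l y → x % 2 ^ l ≡ y % 2 ^ l
bin≡⇒%2^≡ zero    x y _  = trans (n%1≡0 x) (sym (n%1≡0 y))
bin≡⇒%2^≡ (suc l) x y eq = begin
  x % 2 ^ suc l                      ≡⟨ m%[2*n]≡m%n+[m/n%2]*n x ⟩
  x % 2 ^ l + x / 2 ^ l % 2 * 2 ^ l  ≡⟨ cong₂ (λ r β → r + β * 2 ^ l)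
                                          (bin≡⇒%2^≡ l x y (Vec.∷-injectiveʳ eq))
                                          (bit-injective (m%n<n (x / 2 ^ l) 2) (m%n<n (y / 2 ^ l) 2)
                                                         (Vec.∷-injectiveˡ eq)) ⟩
  y % 2 ^ l + y / 2 ^ l % 2 * 2 ^ l  ≡⟨ m%[2*n]≡m%n+[m/n%2]*n y ⟨
  y % 2 ^ suc l                      ∎
  where
  instance
    2^l≢0 : NonZero (2 ^ l)
    2^l≢0 = m^n≢0 2 l

bin-injective : ∀ l {x y} → x < 2 ^ l → y < 2 ^ l → bin l x ≡ bin l y → x ≡ y
bin-injective l {x} {y} x<2^l y<2^l eq = begin
  x          ≡⟨ m<n⇒m%n≡m x<2^l ⟨
  x % 2 ^ l  ≡⟨ bin≡⇒%2^≡ l x y eq ⟩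
  y % 2 ^ l  ≡⟨ m<n⇒m%n≡m y<2^l ⟩
  y          ∎
  where
  instance
    2^l≢0 : NonZero (2 ^ l)
    2^l≢0 = m^n≢0 2 l

n≤2*⌈n/2⌉ : ∀ n → n ≤ 2 * ⌈ n /2⌉
n≤2*⌈n/2⌉ zero          = z≤n
n≤2*⌈n/2⌉ (suc zero)    = s≤s z≤n
n≤2*⌈n/2⌉ (suc (suc n)) rewrite *-suc 2 ⌈ n /2⌉ = s≤s (s≤s (n≤2*⌈n/2⌉ n))

n≤2^⌈log2⌉n : ∀ n (rec : Acc _<_ n) → n ≤ 2 ^ ⌈log2⌉ n rec
n≤2^⌈log2⌉n zero          _        = z≤n
n≤2^⌈log2⌉n (suc zero)    _        = s≤s z≤n
n≤2^⌈log2⌉n (suc (suc n)) (acc rs) =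
  ≤-trans (n≤2*⌈n/2⌉ (suc (suc n))) (*-monoʳ-≤ 2 (n≤2^⌈log2⌉n (suc ⌈ n /2⌉) (rs (⌈n/2⌉<n n))))

n≤2^nbits : ∀ n → n ≤ 2 ^ nbits n
n≤2^nbits n = n≤2^⌈log2⌉n n (<-wellFounded n)

code-injective : ∀ {n} {i j : Fin n} → code i ≡ code j → i ≡ j
code-injective {n} {i} {j} = toℕ-injective ∘ bin-injective (nbits n) (fits i) (fits j)
  where
  fits : (k : Fin n) → toℕ k < 2 ^ nbits n
  fits k = ≤-trans (toℕ<n k) (n≤2^nbits n)

2≤n : ∀ {n} {x y : Fin n} → x ≢ y → 2 ≤ n
2≤n {suc zero}    {fzero} {fzero} x≢y = contradiction refl x≢y
2≤n {suc (suc n)} _                   = s≤s (s≤s z≤n)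

nbits≢0 : ∀ {n} {x y : Fin n} → x ≢ y → nbits n ≢ 0
nbits≢0 x≢y = n>0⇒n≢0 (⌈log₂⌉-mono-≤ (2≤n x≢y))

bitAt : ∀ {m} → Vec Bool m → ℕ → Bool
bitAt []      _       = false
bitAt (x ∷ v) zero    = x
bitAt (x ∷ v) (suc k) = bitAt v k

lookup≡bitAt : ∀ {m} (v : Vec Bool m) (k : Fin m) → lookup v k ≡ bitAt v (toℕ k)
lookup≡bitAt (x ∷ v) fzero    = refl
lookup≡bitAt (x ∷ v) (fsuc k) = lookup≡bitAt v k

lookup-opposite≡bitAt : ∀ {m} (v : Vec Bool m) (k : Fin m) →
                        lookup v (opposite k) ≡ bitAt v (m ∸ suc (toℕ k))
lookup-opposite≡bitAt v k = trans (lookup≡bitAt v (opposite k)) (cong (bitAt v) (opposite-prop k))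

pushed : ∀ {m} → Vec Bool m → ℕ → List Bool
pushed v zero    = []
pushed v (suc k) = bitAt v k ∷ pushed v k

AgreeFrom : ∀ {m} → ℕ → Vec Bool m → Vec Bool m → Set
AgreeFrom {m} r u v = ∀ q → r ≤ q → q < m → bitAt u q ≡ bitAt v q

agreeFrom-length : ∀ {m} (u v : Vec Bool m) → AgreeFrom m u v
agreeFrom-length u v q m≤q q<m = contradiction q<m (≤⇒≯ m≤q)

agreeFrom-extend : ∀ {m r} {u v : Vec Bool m} →
                   bitAt u r ≡ bitAt v r → AgreeFrom (suc r) u v → AgreeFrom r u v
agreeFrom-extend eq agree q r≤q q<m with m≤n⇒m<n∨m≡n r≤q
... | inj₁ r<q  = agree q r<q q<m
... | inj₂ refl = eq

agreeFrom-0 : ∀ {m} {u v : Vec Bool m} → AgreeFrom 0 u v → u ≡ v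
agreeFrom-0 {u = []}    {[]}    _     = refl
agreeFrom-0 {u = x ∷ u} {y ∷ v} agree =
  cong₂ _∷_ (agree 0 z≤n (s≤s z≤n)) (agreeFrom-0 (λ q _ q<m → agree (suc q) z≤n (s≤s q<m)))

Walk : ∀ {A : Set} → (A → A → Set) → ℕ → A → A → Set
Walk E zero    i j = i ≡ j
Walk E (suc k) i j = ∃[ h ] (Walk E k i h × E h j)

closedWalk₃⇒triangle : ∀ {n} {E : Fin n → Fin n → Set} → Symmetric E → Irreflexive _≡_ E →
                       ∀ {x} → Walk E 3 x x → Triangle E
closedWalk₃⇒triangle symE irrE {x} (z , (y , (_ , refl , exy) , eyz) , ezx) =
  x , y , z , (λ eq → irrE eq exy) , (λ eq → irrE eq eyz) , (λ eq → irrE eq (symE ezx)) ,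
  exy , eyz , symE ezx

≡ᵇ-true⇒≡ : ∀ m n → (m ≡ᵇ n) ≡ true → m ≡ n
≡ᵇ-true⇒≡ m n eq = ≡ᵇ⇒≡ m n (subst T (sym eq) _)

-- pushSt x k and popSt x k unfold to this shape.
chain-end : ∀ {A : Set} {first last inner : A} k → k ≢ 0 →
            (if k ≡ᵇ 0 then first else if k ≡ᵇ k then last else inner) ≡ last
chain-end k k≢0 with k ≡ᵇ 0 in k≡0 | k ≡ᵇ k in k≡k
... | true  | _     = contradiction (≡ᵇ-true⇒≡ k 0 k≡0) k≢0
... | false | true  = refl
... | false | false = ⊥-elim (subst T k≡k (≡⇒≡ᵇ k k refl))

remaining⇒< : ∀ {r m b} → suc (r + m) ≡ b → m < b
remaining⇒< {r} {m} eq = subst (m <_) eq (s≤s (m≤n+m m r))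

module Reduction (n : ℕ) (E : Fin n → Fin n → Set) (symE : Symmetric E) (irrE : Irreflexive _≡_ E) where

  B : ℕ
  B = nbits n

  P : PDS
  P = 𝒫 n E

  Steps : Config P → Config P → Set
  Steps = Star (Step P)

  Reached : ℕ → Fin n → List Bool → Set
  Reached k j w = ∃[ i ] (Walk E k i j × w ≡ pushed (code i) B)

  extend : ∀ {k i j w} → Reached k i w → E i j → Reached (suc k) j w
  extend (h , walk , stack) e = h , (_ , walk , e) , stack

  -- r bits remain to be popped; the bits popped so far, at positions ≥ r, agreed with those of i.
  Popping : Fin n → ℕ → List Bool → Set
  Popping j r w = ∃[ i ] (Walk E 3 i j × w ≡ pushed (code i) r × AgreeFrom r (code j) (code i))

  startPopping : ∀ {j w} → Reached 3 j w → Popping j B w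
  startPopping {j} (i , walk , stack) = i , walk , stack , agreeFrom-length (code j) (code i)

  popping-step : ∀ {j r w} → Popping j (suc r) (bitAt (code j) r ∷ w) → Popping j r w
  popping-step {j} (i , walk , stack , agree) =
    i , walk , List.∷-injectiveʳ stack ,
    agreeFrom-extend {u = code j} {code i} (List.∷-injectiveˡ stack) agree

  popping-done : ∀ {j w} → Popping j 0 w → Triangle E
  popping-done {j} (i , walk , _ , agree) =
    closedWalk₃⇒triangle symE irrE (subst (Walk E 3 i) (code-injective (agreeFrom-0 agree)) walk)

  depth : Layer → ℕ
  depth ab = 0
  depth bc = 1
  depth cd = 2

  Inv : State n → List Bool → Set
  Inv q-s             w = w ≡ []
  Inv q-t             w = Triangle E
  Inv (a j)           w = Reached 0 j w
  Inv (b j)           w = Reached 1 j w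
  Inv (c j)           w = Reached 2 j w
  Inv (d j)           w = Popping j B w
  Inv (pushAux i k)   w = w ≡ pushed (code i) k
  Inv (popAux j k)    w = Popping j (B ∸ k) w
  Inv (edgeAux l i j) w = Reached (depth l) i w × E i j

  Inv′ : Config P → Set
  Inv′ (q , w) = Inv q w

  Inv-pushSt⇒ : ∀ i m {w} → m < B → Inv (pushSt i m) w → w ≡ pushed (code i) m
  Inv-pushSt⇒ i zero    _   h = h
  Inv-pushSt⇒ i (suc m) m<B h with suc m ≡ᵇ B in m≡B
  ... | true  = contradiction (≡ᵇ-true⇒≡ (suc m) B m≡B) (<⇒≢ m<B)
  ... | false = h

  Inv-pushSt⇐ : ∀ i m {w} → w ≡ pushed (code i) (suc m) → Inv (pushSt i (suc m)) w
  Inv-pushSt⇐ i m {w} h with suc m ≡ᵇ B in m≡B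
  ... | true  = i , refl , subst (λ t → w ≡ pushed (code i) t) (≡ᵇ-true⇒≡ (suc m) B m≡B) h
  ... | false = h

  Inv-popSt⇒ : ∀ j m {w} → m < B → Inv (popSt j m) w → Popping j (B ∸ m) w
  Inv-popSt⇒ j zero    _   h = h
  Inv-popSt⇒ j (suc m) m<B h with suc m ≡ᵇ B in m≡B
  ... | true  = contradiction (≡ᵇ-true⇒≡ (suc m) B m≡B) (<⇒≢ m<B)
  ... | false = h

  Inv-popSt⇐ : ∀ j m {w} → Popping j (B ∸ suc m) w → Inv (popSt j (suc m)) w
  Inv-popSt⇐ j m {w} h with suc m ≡ᵇ B in m≡B
  ... | true  = popping-done (subst (λ r → Popping j r w) B∸[1+m]≡0 h)
    where
    B∸[1+m]≡0 : B ∸ suc m ≡ 0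
    B∸[1+m]≡0 = m≤n⇒m∸n≡0 (≤-reflexive (sym (≡ᵇ-true⇒≡ (suc m) B m≡B)))
  ... | false = h

  push-preserves : ∀ i (k : Fin B) {w} →
                   Inv (pushSt i (toℕ k)) w → Inv (pushSt i (suc (toℕ k))) (lookup (code i) k ∷ w)
  push-preserves i k h =
    Inv-pushSt⇐ i (toℕ k) (cong₂ _∷_ (lookup≡bitAt (code i) k) (Inv-pushSt⇒ i (toℕ k) (toℕ<n k) h))

  pop-preserves : ∀ j (k : Fin B) {w} →
                  Inv (popSt j (toℕ k)) (lookup (code j) (opposite k) ∷ w) → Inv (popSt j (suc (toℕ k))) w
  pop-preserves j k {w} h = Inv-popSt⇐ j (toℕ k) (popping-step
    (subst₂ (λ r β → Popping j r (β ∷ w)) (+-∸-assoc 1 (toℕ<n k)) (lookup-opposite≡bitAt (code j) k)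
            (Inv-popSt⇒ j (toℕ k) (toℕ<n k) h)))

  step-preserves : ∀ {x y} → Step P x y → Inv′ x → Inv′ y
  step-preserves (step-ε (push i k))        = push-preserves i k
  step-preserves (step-pop (pop j k))       = pop-preserves j k
  step-preserves (step-ε (edge₁ ab i j e)) h = h , e
  step-preserves (step-ε (edge₁ bc i j e)) h = h , e
  step-preserves (step-ε (edge₁ cd i j e)) h = h , e
  step-preserves (step-ε (edge₂ ab i j _)) (h , e) = extend h e
  step-preserves (step-ε (edge₂ bc i j _)) (h , e) = extend h e
  step-preserves (step-ε (edge₂ cd i j _)) (h , e) = startPopping (extend h e)

  steps-preserve : ∀ {x y} → Steps x y → Inv′ x → Inv′ y
  steps-preserve ε        h = h
  steps-preserve (s ◅ ss) h = steps-preserve ss (step-preserves s h)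

  reachable⇒triangle : Reachable P q-s q-t → Triangle E
  reachable⇒triangle run = steps-preserve run refl

  -- Step m of a chain of B steps, followed by r more; the pop chain removes bit r at step m.
  push-step : ∀ x r m {w} → suc (r + m) ≡ B →
              Step P (pushSt x m , w) (pushSt x (suc m) , bitAt (code x) m ∷ w)
  push-step x r m {w} eq with fromℕ< (remaining⇒< {r} {m} eq) | toℕ-fromℕ< (remaining⇒< {r} {m} eq)
  ... | k | refl = subst (λ β → Step P (pushSt x (toℕ k) , w) (pushSt x (suc (toℕ k)) , β ∷ w))
                         (lookup≡bitAt (code x) k) (step-ε (push x k))

  pop-step : ∀ x r m {w} → suc (r + m) ≡ B →
             Step P (popSt x m , bitAt (code x) r ∷ w) (popSt x (suc m) , w)
  pop-step x r m {w} eq with fromℕ< (remaining⇒< {r} {m} eq) | toℕ-fromℕ< (remaining⇒< {r} {m} eq)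
  ... | k | refl = subst (λ β → Step P (popSt x (toℕ k) , β ∷ w) (popSt x (suc (toℕ k)) , w))
                         (trans (lookup-opposite≡bitAt (code x) k) (cong (bitAt (code x)) B∸[1+k]≡r))
                         (step-pop (pop x k))
    where
    B∸[1+k]≡r : B ∸ suc (toℕ k) ≡ r
    B∸[1+k]≡r = trans (cong (_∸ suc (toℕ k)) (sym eq)) (m+n∸n≡m r (toℕ k))

  fill : ∀ x r m → r + m ≡ B → Steps (pushSt x m , pushed (code x) m) (pushSt x B , pushed (code x) B)
  fill x zero    m refl = ε
  fill x (suc r) m eq   = push-step x r m eq ◅ fill x r (suc m) (trans (+-suc r m) eq)

  drain : ∀ x r m → r + m ≡ B → Steps (popSt x m , pushed (code x) r) (popSt x B , [])
  drain x zero    m refl = ε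
  drain x (suc r) m eq   = pop-step x r m eq ◅ drain x r (suc m) (trans (+-suc r m) eq)

  push-chain : ∀ x → B ≢ 0 → Steps (q-s , []) (a x , pushed (code x) B)
  push-chain x B≢0 = subst (λ q → Steps (q-s , []) (q , pushed (code x) B))
                           (chain-end B B≢0) (fill x B 0 (+-identityʳ B))

  pop-chain : ∀ x → B ≢ 0 → Steps (d x , pushed (code x) B) (q-t , [])
  pop-chain x B≢0 = subst (λ q → Steps (d x , pushed (code x) B) (q , []))
                          (chain-end B B≢0) (drain x B 0 (+-identityʳ B))

  edge-steps : ∀ l {i j w} → E i j → Steps (src l i , w) (tgt l j , w)
  edge-steps l {i} {j} e = step-ε (edge₁ l i j e) ◅ step-ε (edge₂ l i j e) ◅ ε

  triangle⇒reachable : Triangle E → Reachable P q-s q-t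
  triangle⇒reachable (x , y , z , x≢y , _ , _ , exy , eyz , exz) =
    push-chain x B≢0 ◅◅
    edge-steps ab exy ◅◅ edge-steps bc eyz ◅◅ edge-steps cd (symE exz) ◅◅
    pop-chain x B≢0
    where
    B≢0 : B ≢ 0
    B≢0 = nbits≢0 x≢y

lemma3 : (n : ℕ) (E : Fin n → Fin n → Set) →
         Symmetric E → Irreflexive _≡_ E →
         Reachable (𝒫 n E) q-s q-t ⇔ Triangle E
lemma3 n E symE irrE = mk⇔ reachable⇒triangle triangle⇒reachable
  where open Reduction n E symE irrE
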